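{- For any simple $[t]$-trade $T$ there exists a simple $[t]$-trade $T'$ with $|\mathrm{found}(T')|=\mathrm{afrk}(T')=\mathrm{afrk}(T)$ and $\mathrm{vol}(T')=\mathrm{vol}(T)$.
   Context: Let $V=\{1,\dots,v\}$; subsets of $V$ are identified with characteristic vectors in $\mathrm{GF}(2)^v$. A $[t]$-trade is a pair $T=(T_+,T_-)$ of disjoint finite multisets of subsets of $V$ (blocks) such that for every $i\in\{0,\dots,t\}$ every $i$-subset of $V$ lies in equally many blocks of $T_+$ and of $T_-$ (with multiplicity); simple means no repeated block; $\mathrm{vol}(T)=|T_+|=|T_-|$; $\mathrm{found}(T)$ is the set of elements of $V$ occurring in some block; $\mathrm{afrk}(T)$ is the dimension of the affine span of $T_+\cup T_-$ in $\mathrm{GF}(2)^v$. -}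

module Defs where

open import Data.Nat using (ℕ; zero; suc; _≤_; _%_)
open import Data.Bool using (Bool; true; false; _xor_)
open import Data.List using (List; []; _∷_; _++_; length; filter)
open import Data.List.Relation.Unary.All using (All)
open import Data.List.Relation.Unary.Unique.Propositional using (Unique)
open import Data.List.Membership.Propositional using (_∈_)
open import Data.Vec using (Vec; []; _∷_; zipWith)
open import Data.Fin.Subset using (Subset; _⊆_; ∣_∣; ⋃) renaming (⊥ to ∅)
open import Data.Fin.Subset.Properties using (_⊆?_)
open import Data.Product using (Σ; _×_; ∃)
open import Relation.Binary.PropositionalEquality using (_≡_; _≢_)
open import Relation.Nullary using (¬_)

-- Blocks are subsets of V = {1..v}, represented as characteristic vectors
-- (Subset v = Vec Bool v), i.e. elements of GF(2)^v.
Block : ℕ → Set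
Block v = Subset v

-- A pair of finite multisets of blocks, each multiset given as a list
-- (all notions below are invariant under reordering).
record Pair (v : ℕ) : Set where
  constructor mkPair
  field
    plus  : List (Block v)
    minus : List (Block v)
open Pair public

cnt : {v : ℕ} → Subset v → List (Block v) → ℕ
cnt s B = length (filter (λ b → s ⊆? b) B)

IsTrade : {v : ℕ} → ℕ → Pair v → Set
IsTrade {v} t T =
  (∀ (b : Block v) → b ∈ plus T → ¬ (b ∈ minus T)) ×
  (∀ (i : ℕ) → i ≤ t → ∀ (s : Subset v) → ∣ s ∣ ≡ i →
     cnt s (plus T) ≡ cnt s (minus T))

Simple : {v : ℕ} → Pair v → Set
Simple T = Unique (plus T) × Unique (minus T)

vol : {v : ℕ} → Pair v → ℕ
vol T = length (plus T)

blocks : {v : ℕ} → Pair v → List (Block v)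
blocks T = plus T ++ minus T

found : {v : ℕ} → Pair v → Subset v
found T = ⋃ (blocks T)

_⊕_ : {v : ℕ} → Subset v → Subset v → Subset v
_⊕_ = zipWith _xor_

sumSel : {v : ℕ} (ps : List (Subset v)) → Vec Bool (length ps) → Subset v
sumSel [] [] = ∅
sumSel (p ∷ ps) (true ∷ c) = p ⊕ sumSel ps c
sumSel (p ∷ ps) (false ∷ c) = sumSel ps c

-- affine independence over GF(2): no nontrivial GF(2)-combination whose
-- coefficients sum to 0 (i.e. an even, nonzero number of 1's) vanishes
AffInd : {v : ℕ} → List (Subset v) → Set
AffInd ps = ∀ (c : Vec Bool (length ps)) → c ≢ ∅ → ∣ c ∣ % 2 ≡ 0 → sumSel ps c ≢ ∅

-- HasAfrk S d : the affine span of the points of S has dimension d, i.e.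
-- the maximum size of an affinely independent family of points of S is d+1.
HasAfrk : {v : ℕ} → List (Subset v) → ℕ → Set
HasAfrk {v} S d =
  (Σ (List (Subset v)) λ ps → length ps ≡ suc d × All (_∈ S) ps × AffInd ps) ×
  (∀ (ps : List (Subset v)) → All (_∈ S) ps → AffInd ps → length ps ≤ suc d)

{-# OPTIONS --safe #-}
module Submission where

-- Choose an affinely independent family p, p₁, …, p_d of blocks of maximal size. By maximality
-- every block b satisfies b + p ∈ span(p₁ + p, …, p_d + p), and Gaussian elimination on this
-- span yields a set I of d pivot coordinates such that x ↦ I ∩ x is injective on it. Hence the
-- affine map b ↦ I ∩ (b + p) is injective on the blocks: it keeps the trade simple, keeps its
-- volume and affine rank, and its image has foundation exactly I. It maps [t]-trades to
-- [t]-trades, because translation by p is a composite of complementations of single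
-- coordinates, and both complementation and restriction to I preserve the counts of blocks
-- through every set of at most t points.

open import Defs
open import Algebra.Bundles using (CommutativeSemigroup)
import Algebra.Properties.CommutativeSemigroup as CommutativeSemigroupProperties
open import Data.Bool using (Bool; true; false; _xor_; not; _∧_)
import Data.Bool as Bool
open import Data.Bool.Properties
  using (xor-assoc; xor-comm; xor-identityˡ; xor-identityʳ; xor-same; not-distribˡ-xor; ∧-distribˡ-xor; ∧-zeroʳ)
open import Data.Empty using (⊥-elim)
open import Data.Fin using (Fin; zero; suc)
open import Data.Fin.Subset using (Subset; ∣_∣; _∩_; _∪_; ⋃; ⁅_⁆; _⊆_; Nonempty)
  renaming (⊥ to ∅; _∈_ to _∈ₛ_; _∉_ to _∉ₛ_)
open import Data.Fin.Subset.Properties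
  using (_⊆?_; anySubset?; nonempty?; Empty-unique; ∉⊥; ⊥⊆; ⊆-antisym; ∣⊥∣≡0; x∈⁅x⁆; x∈⁅y⁆⇒x≡y;
         x∈p∪q⁺; x∈p∪q⁻; x∈p∩q⁺; x∈p∩q⁻; q⊆p∪q; p∩q⊆p; ∪-identityˡ; ∩-zeroʳ; ∩-distribˡ-∪)
  renaming (_∈?_ to _∈ₛ?_)
open import Data.List using (List; []; _∷_; map; length)
open import Data.List.Membership.Propositional using (_∈_)
open import Data.List.Membership.Propositional.Properties using (∈-map⁺; ∈-map⁻; ∈-++⁺ˡ; ∈-++⁺ʳ)
open import Data.List.Properties using (length-map; map-∘; map-cong; map-id; map-++)
open import Data.List.Relation.Unary.All using (All; []; _∷_)
import Data.List.Relation.Unary.All as All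
import Data.List.Relation.Unary.All.Properties as All
open import Data.List.Relation.Unary.AllPairs using ([]; _∷_)
open import Data.List.Relation.Unary.Any using (here; there)
open import Data.List.Relation.Unary.Unique.Propositional using (Unique)
open import Data.Nat using (ℕ; zero; suc; _+_; _≤_; _%_)
import Data.Nat as ℕ
open import Data.Nat.Properties
  using (+-commutativeSemigroup; +-identityʳ; +-cancelʳ-≡; suc-injective; ≤-trans; ≤-reflexive; n≤1+n; 1+n≰n)
open import Data.Product using (Σ; ∃; _×_; _,_; proj₁; proj₂)
open import Data.Sum using (inj₁; inj₂)
open import Data.Vec using ([]; _∷_; lookup; here; there)
open import Data.Vec.Properties
  using (zipWith-assoc; zipWith-comm; zipWith-identityˡ; zipWith-identityʳ; zipWith-distribˡ;
         lookup-zipWith; lookup-replicate; []=⇒lookup; lookup⇒[]=; ∷-injective; ≡-dec)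
open import Function using (_∘_)
open import Relation.Binary.PropositionalEquality
open import Relation.Binary.PropositionalEquality.Algebra using (isMagma)
open import Relation.Nullary using (¬_; Dec; does; yes; no; ¬?; contradiction)
open import Relation.Nullary.Decidable using (_×-dec_)

-- Linear algebra over GF(2)

⊕-assoc : ∀ {n} (x y z : Subset n) → (x ⊕ y) ⊕ z ≡ x ⊕ (y ⊕ z)
⊕-assoc = zipWith-assoc xor-assoc

⊕-comm : ∀ {n} (x y : Subset n) → x ⊕ y ≡ y ⊕ x
⊕-comm = zipWith-comm xor-comm

⊕-identityˡ : ∀ {n} (x : Subset n) → ∅ ⊕ x ≡ x
⊕-identityˡ = zipWith-identityˡ xor-identityˡ

⊕-identityʳ : ∀ {n} (x : Subset n) → x ⊕ ∅ ≡ x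
⊕-identityʳ = zipWith-identityʳ xor-identityʳ

x⊕x≡∅ : ∀ {n} (x : Subset n) → x ⊕ x ≡ ∅
x⊕x≡∅ [] = refl
x⊕x≡∅ (a ∷ x) = cong₂ _∷_ (xor-same a) (x⊕x≡∅ x)

x⊕y⊕y≡x : ∀ {n} (x y : Subset n) → (x ⊕ y) ⊕ y ≡ x
x⊕y⊕y≡x x y = trans (⊕-assoc x y y) (trans (cong (x ⊕_) (x⊕x≡∅ y)) (⊕-identityʳ x))

⊕≡∅⇒≡ : ∀ {n} {x y : Subset n} → x ⊕ y ≡ ∅ → x ≡ y
⊕≡∅⇒≡ {x = x} {y} x⊕y≡∅ = trans (sym (x⊕y⊕y≡x x y)) (trans (cong (_⊕ y) x⊕y≡∅) (⊕-identityˡ y))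

⊕-commutativeSemigroup : ℕ → CommutativeSemigroup _ _
⊕-commutativeSemigroup n = record
  { isCommutativeSemigroup = record
    { isSemigroup = record { isMagma = isMagma (_⊕_ {n}) ; assoc = ⊕-assoc }
    ; comm = ⊕-comm
    }
  }

⊕-interchange : ∀ {n} (w x y z : Subset n) → (w ⊕ x) ⊕ (y ⊕ z) ≡ (w ⊕ y) ⊕ (x ⊕ z)
⊕-interchange {n} = CommutativeSemigroupProperties.interchange (⊕-commutativeSemigroup n)

∩-distribˡ-⊕ : ∀ {n} (I x y : Subset n) → I ∩ (x ⊕ y) ≡ (I ∩ x) ⊕ (I ∩ y)
∩-distribˡ-⊕ = zipWith-distribˡ ∧-distribˡ-xor

infixr 25 _·_

_·_ : ∀ {n} → Bool → Subset n → Subset n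
true  · u = u
false · u = ∅

·-distribʳ-xor : ∀ {n} a b (u : Subset n) → (a xor b) · u ≡ a · u ⊕ b · u
·-distribʳ-xor true  true  u = sym (x⊕x≡∅ u)
·-distribʳ-xor true  false u = sym (⊕-identityʳ u)
·-distribʳ-xor false b     u = sym (⊕-identityˡ (b · u))

u⊕b·u≡not-b·u : ∀ {n} b (u : Subset n) → u ⊕ b · u ≡ not b · u
u⊕b·u≡not-b·u true  u = x⊕x≡∅ u
u⊕b·u≡not-b·u false u = ⊕-identityʳ u

b·∅≡∅ : ∀ {n} b → b · ∅ {n} ≡ ∅
b·∅≡∅ true  = refl
b·∅≡∅ false = refl

IsLinear : ∀ {m n} → (Subset m → Subset n) → Set
IsLinear g = ∀ x y → g (x ⊕ y) ≡ g x ⊕ g y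

linear-∅ : ∀ {m n} {g : Subset m → Subset n} → IsLinear g → g ∅ ≡ ∅
linear-∅ {g = g} linear = begin
  g ∅             ≡⟨ cong g (sym (⊕-identityˡ ∅)) ⟩
  g (∅ ⊕ ∅)       ≡⟨ linear ∅ ∅ ⟩
  g ∅ ⊕ g ∅       ≡⟨ x⊕x≡∅ (g ∅) ⟩
  ∅               ∎
  where open ≡-Reasoning

linear-· : ∀ {m n} {g : Subset m → Subset n} → IsLinear g → ∀ b x → g (b · x) ≡ b · g x
linear-· linear true  x = refl
linear-· linear false x = linear-∅ linear

-- Combinations and affine independence

sumSel-∷ : ∀ {n} (p : Subset n) ps b c → sumSel (p ∷ ps) (b ∷ c) ≡ b · p ⊕ sumSel ps c
sumSel-∷ p ps true  c = refl
sumSel-∷ p ps false c = sym (⊕-identityˡ (sumSel ps c))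

sumSel-∅ : ∀ {n} (ps : List (Subset n)) → sumSel ps ∅ ≡ ∅
sumSel-∅ []       = refl
sumSel-∅ (p ∷ ps) = sumSel-∅ ps

sumSel-⊕ : ∀ {n} (ps : List (Subset n)) c c′ → sumSel ps (c ⊕ c′) ≡ sumSel ps c ⊕ sumSel ps c′
sumSel-⊕ []       []      []        = sym (⊕-identityˡ ∅)
sumSel-⊕ (p ∷ ps) (a ∷ c) (b ∷ c′) = begin
  sumSel (p ∷ ps) ((a xor b) ∷ (c ⊕ c′))             ≡⟨ sumSel-∷ p ps (a xor b) (c ⊕ c′) ⟩
  (a xor b) · p ⊕ sumSel ps (c ⊕ c′)                 ≡⟨ cong₂ _⊕_ (·-distribʳ-xor a b p) (sumSel-⊕ ps c c′) ⟩
  (a · p ⊕ b · p) ⊕ (sumSel ps c ⊕ sumSel ps c′)      ≡⟨ ⊕-interchange _ _ _ _ ⟩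
  (a · p ⊕ sumSel ps c) ⊕ (b · p ⊕ sumSel ps c′)      ≡⟨ sym (cong₂ _⊕_ (sumSel-∷ p ps a c) (sumSel-∷ p ps b c′)) ⟩
  sumSel (p ∷ ps) (a ∷ c) ⊕ sumSel (p ∷ ps) (b ∷ c′) ∎
  where open ≡-Reasoning

parity : ∀ {n} → Subset n → Bool
parity []      = false
parity (b ∷ c) = b xor parity c

χ : Bool → ℕ
χ true  = 1
χ false = 0

private
  suc-%2 : ∀ m b → m % 2 ≡ χ b → suc m % 2 ≡ χ (not b)
  suc-%2 zero          false _  = refl
  suc-%2 (suc zero)    true  _  = refl
  suc-%2 (suc (suc m)) b     eq = suc-%2 m b eq

∣c∣%2≡χ-parity : ∀ {n} (c : Subset n) → ∣ c ∣ % 2 ≡ χ (parity c)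
∣c∣%2≡χ-parity []          = refl
∣c∣%2≡χ-parity (false ∷ c) = ∣c∣%2≡χ-parity c
∣c∣%2≡χ-parity (true ∷ c)  = suc-%2 ∣ c ∣ (parity c) (∣c∣%2≡χ-parity c)

even⇒parity≡false : ∀ {n} (c : Subset n) → ∣ c ∣ % 2 ≡ 0 → parity c ≡ false
even⇒parity≡false c even with parity c | ∣c∣%2≡χ-parity c
... | false | _    = refl
... | true  | odd  with () ← trans (sym odd) even

parity≡false⇒even : ∀ {n} (c : Subset n) → parity c ≡ false → ∣ c ∣ % 2 ≡ 0
parity≡false⇒even c parity≡false = trans (∣c∣%2≡χ-parity c) (cong χ parity≡false)

-- length (map h xs) is not definitionally length xs, so coefficient vectors are moved along map by hand.
module Reindex {A B : Set} (h : A → B) where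

  push : ∀ xs → Subset (length xs) → Subset (length (map h xs))
  push []       []      = []
  push (x ∷ xs) (b ∷ c) = b ∷ push xs c

  pull : ∀ xs → Subset (length (map h xs)) → Subset (length xs)
  pull []       []      = []
  pull (x ∷ xs) (b ∷ c) = b ∷ pull xs c

  push-pull : ∀ xs c → push xs (pull xs c) ≡ c
  push-pull []       []      = refl
  push-pull (x ∷ xs) (b ∷ c) = cong (b ∷_) (push-pull xs c)

  parity-push : ∀ xs c → parity (push xs c) ≡ parity c
  parity-push []       []      = refl
  parity-push (x ∷ xs) (b ∷ c) = cong (b xor_) (parity-push xs c)

  push-≢∅ : ∀ xs {c} → c ≢ ∅ → push xs c ≢ ∅
  push-≢∅ []       {[]}        c≢∅ _  = c≢∅ refl
  push-≢∅ (x ∷ xs) {false ∷ c} c≢∅ eq = push-≢∅ xs (c≢∅ ∘ cong (false ∷_)) (proj₂ (∷-injective eq))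

  pull-≢∅ : ∀ xs {c} → c ≢ ∅ → pull xs c ≢ ∅
  pull-≢∅ []       {[]}        c≢∅ _  = c≢∅ refl
  pull-≢∅ (x ∷ xs) {false ∷ c} c≢∅ eq = pull-≢∅ xs (c≢∅ ∘ cong (false ∷_)) (proj₂ (∷-injective eq))

open Reindex

Span : ∀ {n} → List (Subset n) → Subset n → Set
Span us x = ∃ λ c → sumSel us c ≡ x

Independent : ∀ {n} → List (Subset n) → Set
Independent us = ∀ c → c ≢ ∅ → sumSel us c ≢ ∅

span-⊕ : ∀ {n} {us : List (Subset n)} {x y} → Span us x → Span us y → Span us (x ⊕ y)
span-⊕ {us = us} (c , refl) (c′ , refl) = c ⊕ c′ , sumSel-⊕ us c c′

All-∈-map⁻ : ∀ {A B : Set} {h : A → B} {S} qs → All (_∈ map h S) qs →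
             ∃ λ rs → All (_∈ S) rs × map h rs ≡ qs
All-∈-map⁻ []       []           = [] , [] , refl
All-∈-map⁻ (q ∷ qs) (q∈hS ∷ qs∈hS) with ∈-map⁻ _ q∈hS | All-∈-map⁻ qs qs∈hS
... | r , r∈S , refl | rs , rs∈S , refl = r ∷ rs , r∈S ∷ rs∈S , refl

module _ {m n} {g : Subset m → Subset n} (linear : IsLinear g) (q : Subset n)
         {h : Subset m → Subset n} (h≗ : ∀ x → h x ≡ g x ⊕ q) where

  sumSel-affine : ∀ xs c → sumSel (map h xs) (push h xs c) ≡ g (sumSel xs c) ⊕ parity c · q
  sumSel-affine []       []          = sym (trans (⊕-identityʳ (g ∅)) (linear-∅ linear))
  sumSel-affine (x ∷ xs) (false ∷ c) = sumSel-affine xs c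
  sumSel-affine (x ∷ xs) (true ∷ c)  = begin
    h x ⊕ sumSel (map h xs) (push h xs c)      ≡⟨ cong₂ _⊕_ (h≗ x) (sumSel-affine xs c) ⟩
    (g x ⊕ q) ⊕ (g S ⊕ parity c · q)           ≡⟨ ⊕-interchange _ _ _ _ ⟩
    (g x ⊕ g S) ⊕ (q ⊕ parity c · q)           ≡⟨ cong₂ _⊕_ (sym (linear x S)) (u⊕b·u≡not-b·u (parity c) q) ⟩
    g (x ⊕ S) ⊕ not (parity c) · q             ∎
    where open ≡-Reasoning
          S = sumSel xs c

  private
    even-sumSel-affine : ∀ xs c → parity c ≡ false → sumSel (map h xs) (push h xs c) ≡ g (sumSel xs c)
    even-sumSel-affine xs c parity≡false = begin
      sumSel (map h xs) (push h xs c)  ≡⟨ sumSel-affine xs c ⟩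
      g (sumSel xs c) ⊕ parity c · q   ≡⟨ cong (λ b → g (sumSel xs c) ⊕ b · q) parity≡false ⟩
      g (sumSel xs c) ⊕ ∅              ≡⟨ ⊕-identityʳ _ ⟩
      g (sumSel xs c)                  ∎
      where open ≡-Reasoning

  affInd-map⁻ : ∀ xs → AffInd (map h xs) → AffInd xs
  affInd-map⁻ xs affInd c c≢∅ even sum≡∅ =
    affInd (push h xs c) (push-≢∅ h xs c≢∅)
      (parity≡false⇒even (push h xs c) (trans (parity-push h xs c) parity≡false))
      (trans (even-sumSel-affine xs c parity≡false) (trans (cong g sum≡∅) (linear-∅ linear)))
    where parity≡false = even⇒parity≡false c even

  affInd-map : ∀ xs → (∀ c → parity c ≡ false → g (sumSel xs c) ≡ ∅ → sumSel xs c ≡ ∅) →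
               AffInd xs → AffInd (map h xs)
  affInd-map xs faithful affInd c″ c″≢∅ even sum≡∅ =
    affInd c (pull-≢∅ h xs c″≢∅) (parity≡false⇒even c parity≡false) (faithful c parity≡false g≡∅)
    where
    c = pull h xs c″
    parity≡false : parity c ≡ false
    parity≡false = begin
      parity c                  ≡⟨ sym (parity-push h xs c) ⟩
      parity (push h xs c)      ≡⟨ cong parity (push-pull h xs c″) ⟩
      parity c″                 ≡⟨ even⇒parity≡false c″ even ⟩
      false                     ∎
      where open ≡-Reasoning
    g≡∅ : g (sumSel xs c) ≡ ∅
    g≡∅ = begin
      g (sumSel xs c)                  ≡⟨ sym (even-sumSel-affine xs c parity≡false) ⟩
      sumSel (map h xs) (push h xs c)  ≡⟨ cong (sumSel (map h xs)) (push-pull h xs c″) ⟩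
      sumSel (map h xs) c″             ≡⟨ sum≡∅ ⟩
      ∅                                ∎
      where open ≡-Reasoning

  hasAfrk-map : ∀ {S d} ps → length ps ≡ suc d → All (_∈ S) ps → AffInd (map h ps) →
                (∀ qs → All (_∈ S) qs → AffInd qs → length qs ≤ suc d) → HasAfrk (map h S) d
  hasAfrk-map ps len ps∈S affInd maximal =
    (map h ps , trans (length-map h ps) len , All.map⁺ (All.map (∈-map⁺ h) ps∈S) , affInd) , maximal′
    where
    maximal′ : ∀ qs → All (_∈ map h _) qs → AffInd qs → length qs ≤ suc _
    maximal′ qs qs∈hS affInd-qs with All-∈-map⁻ {h = h} qs qs∈hS
    ... | rs , rs∈S , refl =
      ≤-trans (≤-reflexive (length-map h rs)) (maximal rs rs∈S (affInd-map⁻ rs affInd-qs))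

sumSel-linear : ∀ {m n} {g : Subset m → Subset n} → IsLinear g →
                ∀ xs c → sumSel (map g xs) (push g xs c) ≡ g (sumSel xs c)
sumSel-linear {g = g} linear xs c = begin
  sumSel (map g xs) (push g xs c)  ≡⟨ sumSel-affine linear ∅ (λ x → sym (⊕-identityʳ (g x))) xs c ⟩
  g (sumSel xs c) ⊕ parity c · ∅   ≡⟨ cong (g (sumSel xs c) ⊕_) (b·∅≡∅ (parity c)) ⟩
  g (sumSel xs c) ⊕ ∅              ≡⟨ ⊕-identityʳ _ ⟩
  g (sumSel xs c)                  ∎
  where open ≡-Reasoning

span-map : ∀ {m n} {g : Subset m → Subset n} → IsLinear g →
           ∀ {us x} → Span us x → Span (map g us) (g x)
span-map linear {us} (c , refl) = push _ us c , sumSel-linear linear us c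

sumSel-even : ∀ {n} (p : Subset n) ps c →
              sumSel (p ∷ ps) (parity c ∷ c) ≡ sumSel (map (_⊕ p) ps) (push (_⊕ p) ps c)
sumSel-even p ps c = begin
  sumSel (p ∷ ps) (parity c ∷ c)            ≡⟨ sumSel-∷ p ps (parity c) c ⟩
  parity c · p ⊕ sumSel ps c                ≡⟨ ⊕-comm _ _ ⟩
  sumSel ps c ⊕ parity c · p                ≡⟨ sym (sumSel-affine (λ _ _ → refl) p (λ _ → refl) ps c) ⟩
  sumSel (map (_⊕ p) ps) (push (_⊕ p) ps c) ∎
  where open ≡-Reasoning

even-combination∈span : ∀ {n} (p : Subset n) ps c → parity c ≡ false →
                        Span (map (_⊕ p) ps) (sumSel (p ∷ ps) c)
even-combination∈span p ps (b ∷ c) even =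
  push (_⊕ p) ps c , trans (sym (sumSel-even p ps c)) (cong (λ a → sumSel (p ∷ ps) (a ∷ c)) (sym b≡parity))
  where
  xor≡false⇒≡ : ∀ a a′ → a xor a′ ≡ false → a ≡ a′
  xor≡false⇒≡ true  true  _ = refl
  xor≡false⇒≡ false false _ = refl
  b≡parity = xor≡false⇒≡ b (parity c) even

affInd⇒independent : ∀ {n} {p : Subset n} {ps} → AffInd (p ∷ ps) → Independent (map (_⊕ p) ps)
affInd⇒independent {p = p} {ps} affInd c″ c″≢∅ sum≡∅ =
  affInd (parity c ∷ c) (pull-≢∅ _ ps c″≢∅ ∘ proj₂ ∘ ∷-injective)
    (parity≡false⇒even (parity c ∷ c) (xor-same (parity c)))
    (trans (sumSel-even p ps c) (trans (cong (sumSel (map (_⊕ p) ps)) (push-pull _ ps c″)) sum≡∅))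
  where c = pull (_⊕ p) ps c″

AffineDependence : ∀ {n} → List (Subset n) → Set
AffineDependence ps = ∃ λ c → c ≢ ∅ × ∣ c ∣ % 2 ≡ 0 × sumSel ps c ≡ ∅

affineDependence? : ∀ {n} (ps : List (Subset n)) → Dec (AffineDependence ps)
affineDependence? ps = anySubset? λ c → ¬? (c ≟ₛ ∅) ×-dec (∣ c ∣ % 2 ℕ.≟ 0) ×-dec (sumSel ps c ≟ₛ ∅)
  where
  _≟ₛ_ : ∀ {m} (x y : Subset m) → Dec (x ≡ y)
  _≟ₛ_ = ≡-dec Bool._≟_

¬affInd⇒dependence : ∀ {n} (ps : List (Subset n)) → ¬ AffInd ps → AffineDependence ps
¬affInd⇒dependence ps ¬affInd with affineDependence? ps
... | yes dependence = dependence
... | no ¬dependence = contradiction (λ c c≢∅ even sum≡∅ → ¬dependence (c , c≢∅ , even , sum≡∅)) ¬affInd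

dependent-extension⇒span : ∀ {n} {b p : Subset n} {ps} → AffInd (p ∷ ps) → ¬ AffInd (b ∷ p ∷ ps) →
                           Span (map (_⊕ p) ps) (b ⊕ p)
dependent-extension⇒span {b = b} {p} {ps} affInd ¬affInd with ¬affInd⇒dependence (b ∷ p ∷ ps) ¬affInd
... | false ∷ c , c≢∅ , even , sum≡∅ = ⊥-elim (affInd c (c≢∅ ∘ cong (false ∷_)) even sum≡∅)
... | true ∷ y ∷ c , _ , even , sum≡∅ =
  subst (Span (map (_⊕ p) ps)) combination≡b⊕p (even-combination∈span p ps (not y ∷ c) parity≡false)
  where
  parity≡false : not y xor parity c ≡ false
  parity≡false = trans (sym (not-distribˡ-xor y (parity c))) (even⇒parity≡false (true ∷ y ∷ c) even)
  S = sumSel ps c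
  combination≡b⊕p : sumSel (p ∷ ps) (not y ∷ c) ≡ b ⊕ p
  combination≡b⊕p = begin
    sumSel (p ∷ ps) (not y ∷ c)  ≡⟨ sumSel-∷ p ps (not y) c ⟩
    not y · p ⊕ S                ≡⟨ cong (_⊕ S) (sym (u⊕b·u≡not-b·u y p)) ⟩
    (p ⊕ y · p) ⊕ S              ≡⟨ ⊕-assoc p (y · p) S ⟩
    p ⊕ (y · p ⊕ S)              ≡⟨ ⊕-comm p _ ⟩
    (y · p ⊕ S) ⊕ p              ≡⟨ cong (_⊕ p) (sym (sumSel-∷ p ps y c)) ⟩
    sumSel (p ∷ ps) (y ∷ c) ⊕ p  ≡⟨ cong (_⊕ p) (sym (⊕≡∅⇒≡ sum≡∅)) ⟩
    b ⊕ p                        ∎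
    where open ≡-Reasoning

≢∅⇒nonempty : ∀ {n} {p : Subset n} → p ≢ ∅ → Nonempty p
≢∅⇒nonempty {p = p} p≢∅ with nonempty? p
... | yes nonempty = nonempty
... | no  empty    = contradiction (Empty-unique empty) p≢∅

∉⇒lookup≡false : ∀ {n} {i : Fin n} {p} → i ∉ₛ p → lookup p i ≡ false
∉⇒lookup≡false {i = i} {p} i∉p with lookup p i in eq
... | false = refl
... | true  = contradiction (lookup⇒[]= i p eq) i∉p

∩≡∅⇒∉ : ∀ {n} {i : Fin n} {p x} → i ∈ₛ p → p ∩ x ≡ ∅ → i ∉ₛ x
∩≡∅⇒∉ i∈p p∩x≡∅ i∈x = ∉⊥ (subst (_ ∈ₛ_) p∩x≡∅ (x∈p∩q⁺ (i∈p , i∈x)))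

⊆-∩≡∅ : ∀ {n} {p q x : Subset n} → p ⊆ q → q ∩ x ≡ ∅ → p ∩ x ≡ ∅
⊆-∩≡∅ {p = p} {x = x} p⊆q q∩x≡∅ = Empty-unique λ (i , i∈p∩x) →
  let i∈p , i∈x = x∈p∩q⁻ p x i∈p∩x in ∩≡∅⇒∉ (p⊆q i∈p) q∩x≡∅ i∈x

⊕⊆∪ : ∀ {n} (x y : Subset n) → x ⊕ y ⊆ x ∪ y
⊕⊆∪ (true  ∷ x) (false ∷ y) here      = here
⊕⊆∪ (false ∷ x) (true  ∷ y) here      = here
⊕⊆∪ (_     ∷ x) (_     ∷ y) (there i) = there (⊕⊆∪ x y i)

·⊆ : ∀ {n} b (u : Subset n) → b · u ⊆ u
·⊆ true  u i∈u = i∈u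
·⊆ false u     = ⊥⊆

∈⋃⁺ : ∀ {n} {i : Fin n} {x xs} → x ∈ xs → i ∈ₛ x → i ∈ₛ ⋃ xs
∈⋃⁺ (here refl) i∈x = x∈p∪q⁺ (inj₁ i∈x)
∈⋃⁺ (there x∈xs) i∈x = x∈p∪q⁺ (inj₂ (∈⋃⁺ x∈xs i∈x))

∈⋃⁻ : ∀ {n} {i : Fin n} xs → i ∈ₛ ⋃ xs → ∃ λ x → x ∈ xs × i ∈ₛ x
∈⋃⁻ []       i∈∅ = contradiction i∈∅ ∉⊥
∈⋃⁻ (x ∷ xs) i∈⋃ with x∈p∪q⁻ x (⋃ xs) i∈⋃
... | inj₁ i∈x  = x , here refl , i∈x
... | inj₂ i∈⋃′ = let y , y∈xs , i∈y = ∈⋃⁻ xs i∈⋃′ in y , there y∈xs , i∈y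

∣⁅i⁆∪p∣≡1+∣p∣ : ∀ {n} (i : Fin n) p → i ∉ₛ p → ∣ ⁅ i ⁆ ∪ p ∣ ≡ suc ∣ p ∣
∣⁅i⁆∪p∣≡1+∣p∣ zero    (false ∷ p) _   = cong (suc ∘ ∣_∣) (∪-identityˡ p)
∣⁅i⁆∪p∣≡1+∣p∣ zero    (true  ∷ p) i∉p = contradiction here i∉p
∣⁅i⁆∪p∣≡1+∣p∣ (suc i) (false ∷ p) i∉p = ∣⁅i⁆∪p∣≡1+∣p∣ i p (i∉p ∘ there)
∣⁅i⁆∪p∣≡1+∣p∣ (suc i) (true  ∷ p) i∉p = cong suc (∣⁅i⁆∪p∣≡1+∣p∣ i p (i∉p ∘ there))

∣s⊕⁅j⁆∣ : ∀ {n} {j : Fin n} {s} → j ∈ₛ s → suc ∣ s ⊕ ⁅ j ⁆ ∣ ≡ ∣ s ∣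
∣s⊕⁅j⁆∣ {s = true  ∷ s} here        = cong (suc ∘ ∣_∣) (⊕-identityʳ s)
∣s⊕⁅j⁆∣ {s = false ∷ s} (there j∈s) = ∣s⊕⁅j⁆∣ j∈s
∣s⊕⁅j⁆∣ {s = true  ∷ s} (there j∈s) = cong suc (∣s⊕⁅j⁆∣ j∈s)

∣p∣≡0⇒p≡∅ : ∀ {n} {p : Subset n} → ∣ p ∣ ≡ 0 → p ≡ ∅
∣p∣≡0⇒p≡∅ ∣p∣≡0 = Empty-unique λ (_ , i∈p) → contradiction (trans (∣s⊕⁅j⁆∣ i∈p) ∣p∣≡0) λ ()

⋃-map-∩ : ∀ {n} (I : Subset n) xs → ⋃ (map (I ∩_) xs) ≡ I ∩ ⋃ xs
⋃-map-∩ I []       = sym (∩-zeroʳ I)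
⋃-map-∩ I (x ∷ xs) = trans (cong ((I ∩ x) ∪_) (⋃-map-∩ I xs)) (sym (∩-distribˡ-∪ I x (⋃ xs)))

⊆⇒∩≡ : ∀ {n} {p q : Subset n} → p ⊆ q → p ∩ q ≡ p
⊆⇒∩≡ {p = p} {q} p⊆q = ⊆-antisym (p∩q⊆p p q) (λ i∈p → x∈p∩q⁺ (i∈p , p⊆q i∈p))

-- Pivot coordinates by Gaussian elimination

module Elimination {n} (u : Subset n) (j : Fin n) (j∈u : j ∈ₛ u) where

  eliminate : Subset n → Subset n
  eliminate w = w ⊕ lookup w j · u

  eliminate-linear : IsLinear eliminate
  eliminate-linear x y = begin
    (x ⊕ y) ⊕ lookup (x ⊕ y) j · u              ≡⟨ cong (λ b → (x ⊕ y) ⊕ b · u) (lookup-zipWith _xor_ j x y) ⟩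
    (x ⊕ y) ⊕ (lookup x j xor lookup y j) · u   ≡⟨ cong ((x ⊕ y) ⊕_) (·-distribʳ-xor (lookup x j) (lookup y j) u) ⟩
    (x ⊕ y) ⊕ (lookup x j · u ⊕ lookup y j · u) ≡⟨ ⊕-interchange x y _ _ ⟩
    eliminate x ⊕ eliminate y                   ∎
    where open ≡-Reasoning

  eliminate-clears : ∀ w → j ∉ₛ eliminate w
  eliminate-clears w j∈ = contradiction (trans (sym ([]=⇒lookup j∈)) lookup≡false) λ ()
    where
    lookup-·u : ∀ b → lookup (b · u) j ≡ b
    lookup-·u true  = []=⇒lookup j∈u
    lookup-·u false = lookup-replicate j false
    lookup≡false : lookup (eliminate w) j ≡ false
    lookup≡false = begin
      lookup (eliminate w) j                         ≡⟨ lookup-zipWith _xor_ j w _ ⟩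
      lookup w j xor lookup (lookup w j · u) j       ≡⟨ cong (lookup w j xor_) (lookup-·u (lookup w j)) ⟩
      lookup w j xor lookup w j                      ≡⟨ xor-same (lookup w j) ⟩
      false                                          ∎
      where open ≡-Reasoning

  eliminate-fixes : ∀ w → j ∉ₛ w → eliminate w ≡ w
  eliminate-fixes w j∉w = trans (cong (λ b → w ⊕ b · u) (∉⇒lookup≡false j∉w)) (⊕-identityʳ w)

  eliminate-kills : eliminate u ≡ ∅
  eliminate-kills = trans (cong (λ b → u ⊕ b · u) ([]=⇒lookup j∈u)) (x⊕x≡∅ u)

  eliminate-⊆ : ∀ w → eliminate w ⊆ w ∪ u
  eliminate-⊆ w i∈ with x∈p∪q⁻ w _ (⊕⊆∪ w (lookup w j · u) i∈)
  ... | inj₁ i∈w   = x∈p∪q⁺ (inj₁ i∈w)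
  ... | inj₂ i∈b·u = x∈p∪q⁺ (inj₂ (·⊆ (lookup w j) u i∈b·u))

  ⋃-eliminate-⊆ : ∀ us → ⋃ (map eliminate us) ⊆ ⋃ (u ∷ us)
  ⋃-eliminate-⊆ us i∈ with ∈⋃⁻ (map eliminate us) i∈
  ... | _ , w′∈ , i∈w′ with ∈-map⁻ eliminate w′∈
  ...   | w , w∈us , refl with x∈p∪q⁻ w u (eliminate-⊆ w i∈w′)
  ...     | inj₁ i∈w = ∈⋃⁺ {xs = u ∷ us} (there w∈us) i∈w
  ...     | inj₂ i∈u = ∈⋃⁺ {xs = u ∷ us} (here refl) i∈u

  j∉⋃-eliminate : ∀ us → j ∉ₛ ⋃ (map eliminate us)
  j∉⋃-eliminate us j∈ with ∈⋃⁻ (map eliminate us) j∈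
  ... | _ , w′∈ , j∈w′ with ∈-map⁻ eliminate w′∈
  ...   | w , _ , refl = eliminate-clears w j∈w′

  eliminate-independent : ∀ {us} → Independent (u ∷ us) → Independent (map eliminate us)
  eliminate-independent {us} independent c″ c″≢∅ sum≡∅ =
    independent (lookup y j ∷ c) (pull-≢∅ eliminate us c″≢∅ ∘ proj₂ ∘ ∷-injective) (begin
      sumSel (u ∷ us) (lookup y j ∷ c)  ≡⟨ sumSel-∷ u us (lookup y j) c ⟩
      lookup y j · u ⊕ y                ≡⟨ cong (_⊕ y) (sym (⊕≡∅⇒≡ eliminate-y≡∅)) ⟩
      y ⊕ y                             ≡⟨ x⊕x≡∅ y ⟩
      ∅                                 ∎)
    where
    open ≡-Reasoning
    c = pull eliminate us c″
    y = sumSel us c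
    eliminate-y≡∅ : eliminate y ≡ ∅
    eliminate-y≡∅ = begin
      eliminate y                                      ≡⟨ sym (sumSel-linear eliminate-linear us c) ⟩
      sumSel (map eliminate us) (push eliminate us c)  ≡⟨ cong (sumSel (map eliminate us)) (push-pull eliminate us c″) ⟩
      sumSel (map eliminate us) c″                     ≡⟨ sum≡∅ ⟩
      ∅                                                ∎

  eliminate-span : ∀ {us x} → Span (u ∷ us) x → j ∉ₛ x → Span (map eliminate us) x
  eliminate-span {us} {x} (b ∷ c , refl) j∉x = subst (Span (map eliminate us)) (sym x≡eliminate-y)
    (span-map eliminate-linear {us} (c , refl))
    where
    open ≡-Reasoning
    y = sumSel us c
    x≡eliminate-y : x ≡ eliminate y
    x≡eliminate-y = begin
      x                                  ≡⟨ sym (eliminate-fixes x j∉x) ⟩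
      eliminate x                        ≡⟨ cong eliminate (sumSel-∷ u us b c) ⟩
      eliminate (b · u ⊕ y)              ≡⟨ eliminate-linear (b · u) y ⟩
      eliminate (b · u) ⊕ eliminate y    ≡⟨ cong (_⊕ eliminate y) (linear-· eliminate-linear b u) ⟩
      b · eliminate u ⊕ eliminate y      ≡⟨ cong (λ z → b · z ⊕ eliminate y) eliminate-kills ⟩
      b · ∅ ⊕ eliminate y                ≡⟨ cong (_⊕ eliminate y) (b·∅≡∅ b) ⟩
      ∅ ⊕ eliminate y                    ≡⟨ ⊕-identityˡ (eliminate y) ⟩
      eliminate y                        ∎

record Pivots {n} (us : List (Subset n)) : Set where
  field
    pivots   : Subset n
    size     : ∣ pivots ∣ ≡ length us
    faithful : ∀ {x} → Span us x → pivots ∩ x ≡ ∅ → x ≡ ∅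
    covered  : pivots ⊆ ⋃ us

-- The recursion is on the length, since map eliminate us is not a structural subterm of u ∷ us.
private
  eliminate-all : ∀ {n} k (us : List (Subset n)) → length us ≡ k → Independent us → Pivots us
  eliminate-all {n} _ [] _ _ = record
    { pivots   = ∅
    ; size     = ∣⊥∣≡0 n
    ; faithful = λ { ([] , refl) _ → refl }
    ; covered  = ⊥⊆
    }
  eliminate-all (suc k) (u ∷ us) len independent = record
    { pivots   = ⁅ j ⁆ ∪ I
    ; size     = trans (∣⁅i⁆∪p∣≡1+∣p∣ j I (j∉⋃-eliminate us ∘ covered′)) (cong suc (trans size′ (length-map eliminate us)))
    ; faithful = λ x∈span pivots∩x≡∅ → faithful′
        (eliminate-span x∈span (∩≡∅⇒∉ (x∈p∪q⁺ (inj₁ (x∈⁅x⁆ j))) pivots∩x≡∅)) (⊆-∩≡∅ (q⊆p∪q ⁅ j ⁆ I) pivots∩x≡∅)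
    ; covered  = covered
    }
    where
    u≢∅ : u ≢ ∅
    u≢∅ u≡∅ = independent (true ∷ ∅) (λ ()) (trans (cong (u ⊕_) (sumSel-∅ us)) (trans (⊕-identityʳ u) u≡∅))
    j   = proj₁ (≢∅⇒nonempty u≢∅)
    j∈u = proj₂ (≢∅⇒nonempty u≢∅)
    open Elimination u j j∈u
    open Pivots (eliminate-all k (map eliminate us) (trans (length-map eliminate us) (cong ℕ.pred len))
                               (eliminate-independent independent))
      renaming (pivots to I; size to size′; faithful to faithful′; covered to covered′)
    covered : ⁅ j ⁆ ∪ I ⊆ ⋃ (u ∷ us)
    covered i∈ with x∈p∪q⁻ ⁅ j ⁆ I i∈
    ... | inj₁ i∈⁅j⁆ = x∈p∪q⁺ (inj₁ (subst (_∈ₛ u) (sym (x∈⁅y⁆⇒x≡y j i∈⁅j⁆)) j∈u))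
    ... | inj₂ i∈I   = ⋃-eliminate-⊆ us (covered′ i∈I)

independent⇒pivots : ∀ {n} {us : List (Subset n)} → Independent us → Pivots us
independent⇒pivots {us = us} = eliminate-all (length us) us refl

-- Block counts under complementation and restriction

infix 10 _⊆ᵇ_

_⊆ᵇ_ : ∀ {n} → Subset n → Subset n → Bool
s ⊆ᵇ b = does (s ⊆? b)

⊆ᵇ-flip-∉ : ∀ {n} {j : Fin n} {s} → j ∉ₛ s → ∀ b → s ⊆ᵇ b ⊕ ⁅ j ⁆ ≡ s ⊆ᵇ b
⊆ᵇ-flip-∉ {j = zero}  {true  ∷ s} j∉s _           = contradiction here j∉s
⊆ᵇ-flip-∉ {j = zero}  {false ∷ s} _   (_ ∷ b)     = cong (s ⊆ᵇ_) (⊕-identityʳ b)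
⊆ᵇ-flip-∉ {j = suc j} {false ∷ s} j∉s (_ ∷ b)     = ⊆ᵇ-flip-∉ (j∉s ∘ there) b
⊆ᵇ-flip-∉ {j = suc j} {true  ∷ s} j∉s (true ∷ b)  = ⊆ᵇ-flip-∉ (j∉s ∘ there) b
⊆ᵇ-flip-∉ {j = suc j} {true  ∷ s} j∉s (false ∷ b) = refl

-- For j ∈ s, s ⊕ ⁅ j ⁆ is s without j; a block contains it iff it contains s before or after
-- complementing coordinate j.
⊆ᵇ-flip-∈ : ∀ {n} {j : Fin n} {s} → j ∈ₛ s → ∀ b →
            χ (s ⊕ ⁅ j ⁆ ⊆ᵇ b) ≡ χ (s ⊆ᵇ b ⊕ ⁅ j ⁆) + χ (s ⊆ᵇ b)
⊆ᵇ-flip-∈ {s = true ∷ s} here (true ∷ b)  rewrite ⊕-identityʳ s = refl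
⊆ᵇ-flip-∈ {s = true ∷ s} here (false ∷ b) rewrite ⊕-identityʳ s | ⊕-identityʳ b = sym (+-identityʳ _)
⊆ᵇ-flip-∈ {s = false ∷ s} (there j∈s) (_ ∷ b)     = ⊆ᵇ-flip-∈ j∈s b
⊆ᵇ-flip-∈ {s = true  ∷ s} (there j∈s) (true ∷ b)  = ⊆ᵇ-flip-∈ j∈s b
⊆ᵇ-flip-∈ {s = true  ∷ s} (there j∈s) (false ∷ b) = refl

⊆ᵇ-∩ : ∀ {n} (s I b : Subset n) → s ⊆ᵇ (I ∩ b) ≡ (s ⊆ᵇ I) ∧ (s ⊆ᵇ b)
⊆ᵇ-∩ []          []         []          = refl
⊆ᵇ-∩ (false ∷ s) (_ ∷ I)    (_ ∷ b)     = ⊆ᵇ-∩ s I b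
⊆ᵇ-∩ (true  ∷ s) (true ∷ I) (true ∷ b)  = ⊆ᵇ-∩ s I b
⊆ᵇ-∩ (true  ∷ s) (true ∷ I) (false ∷ b) = sym (∧-zeroʳ (s ⊆ᵇ I))
⊆ᵇ-∩ (true  ∷ s) (false ∷ I) (_ ∷ b)    = refl

cnt-∷ : ∀ {n} (s b : Subset n) B → cnt s (b ∷ B) ≡ χ (s ⊆ᵇ b) + cnt s B
cnt-∷ s b B with does (s ⊆? b)
... | true  = refl
... | false = refl

cnt-map-cong : ∀ {n} {f : Subset n → Subset n} s → (∀ b → s ⊆ᵇ f b ≡ s ⊆ᵇ b) →
               ∀ X → cnt s (map f X) ≡ cnt s X
cnt-map-cong s _  []      = refl
cnt-map-cong {f = f} s eq (x ∷ X) = begin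
  cnt s (f x ∷ map f X)          ≡⟨ cnt-∷ s (f x) (map f X) ⟩
  χ (s ⊆ᵇ f x) + cnt s (map f X) ≡⟨ cong₂ _+_ (cong χ (eq x)) (cnt-map-cong s eq X) ⟩
  χ (s ⊆ᵇ x) + cnt s X           ≡⟨ sym (cnt-∷ s x X) ⟩
  cnt s (x ∷ X)                  ∎
  where open ≡-Reasoning

cnt-map-none : ∀ {n} {f : Subset n → Subset n} s → (∀ b → s ⊆ᵇ f b ≡ false) →
               ∀ X → cnt s (map f X) ≡ 0
cnt-map-none s _  []      = refl
cnt-map-none {f = f} s eq (x ∷ X) =
  trans (cnt-∷ s (f x) (map f X)) (cong₂ _+_ (cong χ (eq x)) (cnt-map-none s eq X))

cnt-flip-∈ : ∀ {n} {j : Fin n} {s} → j ∈ₛ s → ∀ X →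
             cnt (s ⊕ ⁅ j ⁆) X ≡ cnt s (map (_⊕ ⁅ j ⁆) X) + cnt s X
cnt-flip-∈ j∈s [] = refl
cnt-flip-∈ {j = j} {s} j∈s (x ∷ X) = begin
  cnt (s ⊕ ⁅ j ⁆) (x ∷ X)                                         ≡⟨ cnt-∷ (s ⊕ ⁅ j ⁆) x X ⟩
  χ (s ⊕ ⁅ j ⁆ ⊆ᵇ x) + cnt (s ⊕ ⁅ j ⁆) X                          ≡⟨ cong₂ _+_ (⊆ᵇ-flip-∈ j∈s x) (cnt-flip-∈ j∈s X) ⟩
  (χ (s ⊆ᵇ x ⊕ ⁅ j ⁆) + χ (s ⊆ᵇ x)) + (cnt s (map (_⊕ ⁅ j ⁆) X) + cnt s X)
                                                                  ≡⟨ +-interchange (χ (s ⊆ᵇ x ⊕ ⁅ j ⁆)) (χ (s ⊆ᵇ x)) _ _ ⟩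
  (χ (s ⊆ᵇ x ⊕ ⁅ j ⁆) + cnt s (map (_⊕ ⁅ j ⁆) X)) + (χ (s ⊆ᵇ x) + cnt s X)
                                                                  ≡⟨ sym (cong₂ _+_ (cnt-∷ s (x ⊕ ⁅ j ⁆) _) (cnt-∷ s x X)) ⟩
  cnt s (map (_⊕ ⁅ j ⁆) (x ∷ X)) + cnt s (x ∷ X)                  ∎
  where
  open ≡-Reasoning
  +-interchange : ∀ a b c d → (a + b) + (c + d) ≡ (a + c) + (b + d)
  +-interchange = CommutativeSemigroupProperties.interchange +-commutativeSemigroup

record Balanced {n} (t : ℕ) (X Y : List (Subset n)) : Set where
  constructor balanced
  field agree : ∀ s → ∣ s ∣ ≤ t → cnt s X ≡ cnt s Y

flip-balanced : ∀ {n t} {X Y : List (Subset n)} j →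
                Balanced t X Y → Balanced t (map (_⊕ ⁅ j ⁆) X) (map (_⊕ ⁅ j ⁆) Y)
flip-balanced {t = t} {X} {Y} j (balanced agree) = balanced flipped
  where
  flipped : ∀ s → ∣ s ∣ ≤ t → cnt s (map (_⊕ ⁅ j ⁆) X) ≡ cnt s (map (_⊕ ⁅ j ⁆) Y)
  flipped s ∣s∣≤t with j ∈ₛ? s
  ... | no j∉s  = trans (cnt-map-cong s (⊆ᵇ-flip-∉ j∉s) X)
                    (trans (agree s ∣s∣≤t) (sym (cnt-map-cong s (⊆ᵇ-flip-∉ j∉s) Y)))
  ... | yes j∈s = +-cancelʳ-≡ (cnt s X) _ _ (begin
    cnt s (map (_⊕ ⁅ j ⁆) X) + cnt s X  ≡⟨ sym (cnt-flip-∈ j∈s X) ⟩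
    cnt (s ⊕ ⁅ j ⁆) X                   ≡⟨ agree (s ⊕ ⁅ j ⁆) ∣s⊕⁅j⁆∣≤t ⟩
    cnt (s ⊕ ⁅ j ⁆) Y                   ≡⟨ cnt-flip-∈ j∈s Y ⟩
    cnt s (map (_⊕ ⁅ j ⁆) Y) + cnt s Y  ≡⟨ cong (_ +_) (sym (agree s ∣s∣≤t)) ⟩
    cnt s (map (_⊕ ⁅ j ⁆) Y) + cnt s X  ∎)
    where
    open ≡-Reasoning
    ∣s⊕⁅j⁆∣≤t = ≤-trans (n≤1+n _) (≤-trans (≤-reflexive (∣s⊕⁅j⁆∣ j∈s)) ∣s∣≤t)

restrict-balanced : ∀ {n t} {X Y : List (Subset n)} I →
                    Balanced t X Y → Balanced t (map (I ∩_) X) (map (I ∩_) Y)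
restrict-balanced {t = t} {X} {Y} I (balanced agree) = balanced restricted
  where
  restricted : ∀ s → ∣ s ∣ ≤ t → cnt s (map (I ∩_) X) ≡ cnt s (map (I ∩_) Y)
  restricted s ∣s∣≤t with s ⊆ᵇ I in s⊆I
  ... | true  = trans (cnt-map-cong s kept X) (trans (agree s ∣s∣≤t) (sym (cnt-map-cong s kept Y)))
    where kept = λ b → trans (⊆ᵇ-∩ s I b) (cong (_∧ (s ⊆ᵇ b)) s⊆I)
  ... | false = trans (cnt-map-none s lost X) (sym (cnt-map-none s lost Y))
    where lost = λ b → trans (⊆ᵇ-∩ s I b) (cong (_∧ (s ⊆ᵇ b)) s⊆I)

private
  translate-by-size : ∀ {n t} {X Y : List (Subset n)} k p → ∣ p ∣ ≡ k →
                      Balanced t X Y → Balanced t (map (_⊕ p) X) (map (_⊕ p) Y)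
  translate-by-size {t = t} {X} {Y} zero p ∣p∣≡0 bal =
    subst (λ q → Balanced t (map (_⊕ q) X) (map (_⊕ q) Y)) (sym (∣p∣≡0⇒p≡∅ ∣p∣≡0))
      (subst₂ (Balanced t) (sym (map-⊕∅ X)) (sym (map-⊕∅ Y)) bal)
    where
    map-⊕∅ : ∀ Z → map (_⊕ ∅) Z ≡ Z
    map-⊕∅ Z = trans (map-cong ⊕-identityʳ Z) (map-id Z)
  translate-by-size {n} {t} {X} {Y} (suc k) p ∣p∣≡1+k bal =
    subst₂ (Balanced t) (sym (split X)) (sym (split Y)) (flip-balanced j (translate-by-size k p′ ∣p′∣≡k bal))
    where
    p≢∅ : p ≢ ∅
    p≢∅ p≡∅ = contradiction (trans (sym ∣p∣≡1+k) (trans (cong ∣_∣ p≡∅) (∣⊥∣≡0 n))) λ ()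
    j   = proj₁ (≢∅⇒nonempty p≢∅)
    j∈p = proj₂ (≢∅⇒nonempty p≢∅)
    p′ = p ⊕ ⁅ j ⁆
    ∣p′∣≡k : ∣ p′ ∣ ≡ k
    ∣p′∣≡k = suc-injective (trans (∣s⊕⁅j⁆∣ j∈p) ∣p∣≡1+k)
    split : ∀ Z → map (_⊕ p) Z ≡ map (_⊕ ⁅ j ⁆) (map (_⊕ p′) Z)
    split Z = trans (map-cong (λ b → sym (trans (⊕-assoc b p′ ⁅ j ⁆) (cong (b ⊕_) (x⊕y⊕y≡x p ⁅ j ⁆)))) Z) (map-∘ Z)

translate-balanced : ∀ {n t} {X Y : List (Subset n)} p →
                     Balanced t X Y → Balanced t (map (_⊕ p) X) (map (_⊕ p) Y)
translate-balanced p = translate-by-size ∣ p ∣ p refl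

-- Trades under maps injective on their blocks

InjectiveOn : ∀ {A B : Set} → List A → (A → B) → Set
InjectiveOn xs f = ∀ {x y} → x ∈ xs → y ∈ xs → f x ≡ f y → x ≡ y

unique-map : ∀ {A B : Set} {f : A → B} {xs} → InjectiveOn xs f → Unique xs → Unique (map f xs)
unique-map {xs = []}     _         []                 = []
unique-map {xs = x ∷ xs} injective (x∉xs ∷ unique-xs) =
  All.map⁺ (All.tabulate λ y∈xs fx≡fy → All.lookup x∉xs y∈xs (injective (here refl) (there y∈xs) fx≡fy))
  ∷ unique-map (λ x∈ y∈ → injective (there x∈) (there y∈)) unique-xs

mapPair : ∀ {v} → (Subset v → Subset v) → Pair v → Pair v
mapPair f T = mkPair (map f (plus T)) (map f (minus T))

blocks-mapPair : ∀ {v} (f : Subset v → Subset v) T → blocks (mapPair f T) ≡ map f (blocks T)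
blocks-mapPair f T = sym (map-++ f (plus T) (minus T))

isTrade⇒balanced : ∀ {v t} {T : Pair v} → IsTrade t T → Balanced t (plus T) (minus T)
isTrade⇒balanced (_ , agree) = balanced λ s ∣s∣≤t → agree ∣ s ∣ ∣s∣≤t s refl

module _ {v} {f : Subset v → Subset v} {T : Pair v} (injective : InjectiveOn (blocks T) f) where

  isTrade-mapPair : ∀ {t} → (∀ {X Y} → Balanced t X Y → Balanced t (map f X) (map f Y)) →
                    IsTrade t T → IsTrade t (mapPair f T)
  isTrade-mapPair {t} preserves trade@(disjoint , _) = disjoint′ , agree′
    where
    agree′ : ∀ i → i ≤ t → ∀ s → ∣ s ∣ ≡ i → cnt s (map f (plus T)) ≡ cnt s (map f (minus T))
    agree′ _ ∣s∣≤t s refl = Balanced.agree (preserves {plus T} {minus T} (isTrade⇒balanced trade)) s ∣s∣≤t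
    disjoint′ : ∀ b → b ∈ map f (plus T) → ¬ b ∈ map f (minus T)
    disjoint′ _ b∈fP b∈fM with ∈-map⁻ f b∈fP | ∈-map⁻ f b∈fM
    ... | x , x∈P , refl | y , y∈M , fx≡fy =
      disjoint x x∈P (subst (_∈ minus T) (sym (injective (∈-++⁺ˡ x∈P) (∈-++⁺ʳ (plus T) y∈M) fx≡fy)) y∈M)

  simple-mapPair : Simple T → Simple (mapPair f T)
  simple-mapPair (unique-P , unique-M) =
    unique-map (λ x∈ y∈ → injective (∈-++⁺ˡ x∈) (∈-++⁺ˡ y∈)) unique-P ,
    unique-map (λ x∈ y∈ → injective (∈-++⁺ʳ (plus T) x∈) (∈-++⁺ʳ (plus T) y∈)) unique-M

module Compression {v d} {S : List (Subset v)} {p : Subset v} {ps}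
  (len : length ps ≡ d) (p∷ps∈S : All (_∈ S) (p ∷ ps)) (affInd : AffInd (p ∷ ps))
  (maximal : ∀ qs → All (_∈ S) qs → AffInd qs → length qs ≤ suc d) where

  directions : List (Subset v)
  directions = map (_⊕ p) ps

  open Pivots (independent⇒pivots {us = directions} (affInd⇒independent affInd))

  compress : Subset v → Subset v
  compress b = pivots ∩ (b ⊕ p)

  compress-balanced : ∀ {t X Y} → Balanced t X Y → Balanced t (map compress X) (map compress Y)
  compress-balanced {t} {X} {Y} bal = subst₂ (Balanced t) (sym (map-∘ X)) (sym (map-∘ Y))
    (restrict-balanced pivots (translate-balanced p bal))

  direction-span : ∀ {b} → b ∈ S → Span directions (b ⊕ p)
  direction-span b∈S = dependent-extension⇒span affInd λ affInd′ →
    1+n≰n (subst (λ k → suc (suc k) ≤ suc d) len (maximal (_ ∷ p ∷ ps) (b∈S ∷ p∷ps∈S) affInd′))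

  compress-injective : InjectiveOn S compress
  compress-injective {x} {y} x∈S y∈S compress-x≡compress-y =
    trans (sym (x⊕y⊕y≡x x p)) (trans (cong (_⊕ p) x⊕p≡y⊕p) (x⊕y⊕y≡x y p))
    where
    x⊕p≡y⊕p : x ⊕ p ≡ y ⊕ p
    x⊕p≡y⊕p = ⊕≡∅⇒≡ (faithful (span-⊕ {us = directions} (direction-span x∈S) (direction-span y∈S))
      (trans (∩-distribˡ-⊕ pivots _ _) (trans (cong (_⊕ compress y) compress-x≡compress-y) (x⊕x≡∅ _))))

  found-compress : ⋃ (map compress S) ≡ pivots
  found-compress = begin
    ⋃ (map compress S)                    ≡⟨ cong ⋃ (map-∘ S) ⟩
    ⋃ (map (pivots ∩_) (map (_⊕ p) S))    ≡⟨ ⋃-map-∩ pivots (map (_⊕ p) S) ⟩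
    pivots ∩ ⋃ (map (_⊕ p) S)             ≡⟨ ⊆⇒∩≡ pivots⊆ ⟩
    pivots                                ∎
    where
    open ≡-Reasoning
    pivots⊆ : pivots ⊆ ⋃ (map (_⊕ p) S)
    pivots⊆ i∈pivots with ∈⋃⁻ directions (covered i∈pivots)
    ... | w , w∈directions , i∈w with ∈-map⁻ (_⊕ p) w∈directions
    ...   | x , x∈ps , refl = ∈⋃⁺ (∈-map⁺ (_⊕ p) (All.lookup p∷ps∈S (there x∈ps))) i∈w

  compress-hasAfrk : HasAfrk (map compress S) d
  compress-hasAfrk = hasAfrk-map linear (pivots ∩ p) h≗ (p ∷ ps) (cong suc len) p∷ps∈S
    (affInd-map linear (pivots ∩ p) h≗ (p ∷ ps) (λ c even → faithful (even-combination∈span p ps c even)) affInd)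
    maximal
    where
    linear = ∩-distribˡ-⊕ pivots
    h≗ = λ x → ∩-distribˡ-⊕ pivots x p

  ∣found-compress∣ : ∣ ⋃ (map compress S) ∣ ≡ d
  ∣found-compress∣ = trans (cong ∣_∣ found-compress) (trans size (trans (length-map (_⊕ p) ps) len))

lemma4p6 : ∀ {v t : ℕ} (T : Pair v) → IsTrade t T → Simple T → plus T ≢ [] →
    ∀ (d : ℕ) → HasAfrk (blocks T) d →
    Σ (Pair v) λ T' → IsTrade t T' × Simple T' × vol T' ≡ vol T ×
      ∣ found T' ∣ ≡ d × HasAfrk (blocks T') d
lemma4p6 _ _ _ _ _ (([] , () , _) , _)
lemma4p6 T trade simple _ d ((p ∷ ps , len , p∷ps∈S , affInd) , maximal) =
  mapPair compress T ,
  isTrade-mapPair compress-injective compress-balanced trade ,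
  simple-mapPair compress-injective simple ,
  length-map compress (plus T) ,
  trans (cong (∣_∣ ∘ ⋃) (blocks-mapPair compress T)) ∣found-compress∣ ,
  subst (λ B → HasAfrk B d) (sym (blocks-mapPair compress T)) compress-hasAfrk
  where open Compression (suc-injective len) p∷ps∈S affInd maximal
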